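{- Let $\widetilde X=(X,\mathsf m,\mathsf g)$ be a pure $d$-multicomplex. The following are equivalent: (1) $\widetilde X$ is link-connected; (2) for every $-1\le j\le d-2$ and every $j$-multicell $\mathfrak a$, the link $\mathrm{lk}_{\widetilde X}(\mathfrak a)$ (a $(d-j-1)$-dimensional multicomplex) is $(d-j-1)$-lower path connected.
   Context: Notation $[n]=\{1,\dots,n\}$. A simplicial complex $X$: nonempty family of finite subsets of a countable vertex set closed under inclusion; $\partial\tau=\{\tau\setminus\{v\}:v\in\tau\}$. A $d$-multicomplex $\widetilde X=(X,\mathsf m,\mathsf g)$: $X$ a $d$-dimensional simplicial complex; $\mathsf m:X\to\mathbb N$ with $\mathsf m(\sigma)=1$ if $\dim\sigma\le0$; multicells $(\sigma,r)$, $r\in[\mathsf m(\sigma)]$, with $\iota(\sigma,r)=\sigma$ and $\dim(\sigma,r)=\dim\sigma$; a gluing map $\mathsf g$ assigning to each multicell $\mathfrak a=(\tau,r)$ and $\sigma\in\partial\tau$ a multicell $\mathsf g(\mathfrak a,\sigma)=(\sigma,s)$. Multiboundary $\partial^m\mathfrak a=\{\mathsf g(\mathfrak a,\sigma):\sigma\in\partial\iota(\mathfrak a)\}$; containment $\preceq$ = reflexive-transitive closure of $\mathfrak b\in\partial^m\mathfrak a$; consistency: if equal-dimensional $\mathfrak b=(\sigma,s),\mathfrak b'=(\sigma',s')$ lie in a common multicell and $\rho=\sigma\cap\sigma'$ has dimension $\dim\sigma-1$ then $\mathsf g(\mathfrak b,\rho)=\mathsf g(\mathfrak b',\rho)$.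 Pure: every multicell lies in a $d$-multicell. Two $j$-multicells are neighbours if they contain a common $(j-1)$-multicell; a multicomplex of dimension $n$ is $n$-lower path connected if any two $n$-multicells are joined by a sequence of $n$-multicells with consecutive ones neighbours. Link: for a multicell $\mathfrak a$ with $\rho=\iota(\mathfrak a)$, $\mathrm{lk}_{\widetilde X}(\mathfrak a)$ is the multicomplex whose cells are the $\tau$ with $\tau\cap\rho=\emptyset$ for which some multicell $\mathfrak b\succeq\mathfrak a$ has $\iota(\mathfrak b)=\rho\cup\tau$; its multicells over $\tau$ are the multicells $\mathfrak b\succeq\mathfrak a$ with $\iota(\mathfrak b)=\rho\cup\tau$ (so vertices may have multiplicity), and the gluing sends (the multicell corresponding to $\mathfrak b=(\tau\cup\rho,i)$, $\sigma\in\partial\tau$) to the multicell corresponding to $\mathsf g(\mathfrak b,\sigma\cup\rho)$. $\widetilde X$ is link-connected if for every multicell $\mathfrak a$ of dimension at most $d-2$ (including the empty multicell) the 1-skeleton of $\mathrm{lk}_{\widetilde X}(\mathfrak a)$ is a connected multigraph. -}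

module Defs where

open import Data.Nat using (ℕ; zero; suc; _+_; _∸_; _≤_; _<_)
open import Data.Nat.Properties using (_≟_)
open import Data.Fin using (Fin)
open import Data.List using (List; []; _∷_; length; filter)
open import Data.List.Membership.Propositional using (_∈_; _∉_)
open import Data.List.Membership.DecPropositional _≟_ using (_∈?_)
open import Data.List.Relation.Binary.Subset.Propositional using (_⊆_)
open import Data.List.Relation.Unary.Linked using (Linked)
open import Data.Product using (Σ; ∃; ∃-syntax; _×_; _,_)
open import Relation.Nullary using (¬?)
open import Relation.Binary.PropositionalEquality using (_≡_)
open import Relation.Binary.Construct.Closure.ReflexiveTransitive using (Star)

-- Finite subsets of the (countable) vertex set ℕ are represented by
-- strictly increasing lists (canonical representatives), so that equality
-- of finite sets is propositional equality of lists.

FinSet : List ℕ → Set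
FinSet = Linked _<_

del : ℕ → List ℕ → List ℕ
del v τ = filter (λ x → ¬? (x ≟ v)) τ

_∩_ : List ℕ → List ℕ → List ℕ
σ ∩ σ' = filter (λ x → x ∈? σ') σ

_∈∂_ : List ℕ → List ℕ → Set
σ ∈∂ τ = ∃[ v ] (v ∈ τ × σ ≡ del v τ)

-- Note: "size" of a simplex = number of vertices = dim + 1.

-- Generic graded cell data: cells, their size (dim + 1) and the
-- (multi)boundary relation  bd b a  meaning  b ∈ ∂ᵐ a.

record Cplx : Set₁ where
  field
    Cell : Set
    size : Cell → ℕ
    bd   : Cell → Cell → Set

module CplxNotions (K : Cplx) where
  open Cplx K

  _≼_ : Cell → Cell → Set
  _≼_ = Star bd

  Neighbours : ℕ → Cell → Cell → Set
  Neighbours s a b = size a ≡ s × size b ≡ s ×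
                     ∃[ c ] (suc (size c) ≡ s × c ≼ a × c ≼ b)

  LowerPathConnected : ℕ → Set
  LowerPathConnected s = ∀ a b → size a ≡ s → size b ≡ s → Star (Neighbours s) a b

  Adjacent : Cell → Cell → Set
  Adjacent u w = size u ≡ 1 × size w ≡ 1 × ∃[ e ] (size e ≡ 2 × bd u e × bd w e)

  OneSkeletonConnected : Set
  OneSkeletonConnected = ∀ u w → size u ≡ 1 → size w ≡ 1 → Star Adjacent u w

record MCell (X : List ℕ → Set) (m : List ℕ → ℕ) : Set where
  constructor mc
  field
    cell : List ℕ
    .inX : X cell
    idx  : Fin (m cell)

-- Raw data (X, m, g).  g a σ is the index s of g(a, σ) = (σ, s); it is only
-- meaningful (and only ever used) for σ ∈ ∂ ι(a).
record MultiData : Set₁ where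
  field
    X : List ℕ → Set
    m : List ℕ → ℕ
    g : (a : MCell X m) → (σ : List ℕ) → Fin (m σ)

module MultiNotions (D : MultiData) where
  open MultiData D public
  open MCell public

  MC : Set
  MC = MCell X m

  bdry : MC → MC → Set
  bdry b a = cell b ∈∂ cell a × idx b ≡ g a (cell b)

  Whole : Cplx
  Whole = record { Cell = MC ; size = λ a → length (cell a) ; bd = bdry }

  open CplxNotions Whole public using (_≼_)

  -- the link lk(a): multicells are the b ⪰ a (over τ = ι b ∖ ι a),
  -- gluing (b, σ ∈ ∂τ) ↦ g(b, σ ∪ ι a) = g(b, ι b ∖ {v}) for v ∈ τ
  Link : MC → Cplx
  Link a = record
    { Cell = Σ MC (λ b → a ≼ b)
    ; size = λ { (b , _) → length (cell b) ∸ length (cell a) }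
    ; bd   = λ { (b' , _) (b , _) →
                 ∃[ v ] (v ∈ cell b × v ∉ cell a ×
                         cell b' ≡ del v (cell b) × idx b' ≡ g b (cell b')) }
    }

record IsMulticomplex (d : ℕ) (D : MultiData) : Set where
  open MultiNotions D
  field
    X-finset   : ∀ σ → X σ → FinSet σ
    X-nonempty : ∃[ σ ] X σ
    X-closed   : ∀ σ τ → X τ → FinSet σ → σ ⊆ τ → X σ
    X-dim≤     : ∀ σ → X σ → length σ ≤ suc d
    X-dim≥     : ∃[ σ ] (X σ × length σ ≡ suc d)
    m-pos      : ∀ σ → X σ → 1 ≤ m σ
    m-low      : ∀ σ → X σ → length σ ≤ 1 → m σ ≡ 1
    consistent : ∀ (b b' c : MC) → b ≼ c → b' ≼ c →
                 length (cell b) ≡ length (cell b') →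
                 suc (length (cell b ∩ cell b')) ≡ length (cell b) →
                 g b (cell b ∩ cell b') ≡ g b' (cell b ∩ cell b')

module _ (d : ℕ) (D : MultiData) where
  open MultiNotions D

  Pure : Set
  Pure = ∀ (a : MC) → ∃[ b ] (length (cell b) ≡ suc d × a ≼ b)

  -- every multicell of dimension ≤ d-2 (size ≤ d-1), including the empty
  -- one, has a link with connected 1-skeleton
  LinkConnected : Set
  LinkConnected = ∀ (a : MC) → length (cell a) + 1 ≤ d →
                  CplxNotions.OneSkeletonConnected (Link a)

  -- for -1 ≤ j ≤ d-2 and every j-multicell a (size j+1), lk(a) is
  -- (d-j-1)-lower path connected (top cells of size d - j = suc d ∸ size a)
  LinksLowerPathConnected : Set
  LinksLowerPathConnected = ∀ (a : MC) → length (cell a) + 1 ≤ d →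
                  CplxNotions.LowerPathConnected (Link a) (suc d ∸ length (cell a))

-- In a consistent multicomplex, containment below a common multicell is decided by vertex sets:
-- if a ≼ t and a facet c of t contains the vertices of a, then a ≼ c, because consistency
-- identifies the two copies of c ∩ c' lying under c and under another facet c' of t.
-- Consequently two vertices u, w of lk(a) inside a top cell T span an edge of lk(a) inside T,
-- and a path of neighbouring top cells of lk(a) yields an edge path from u to w (2 ⇒ 1).
-- Conversely, argue by induction on the codimension of a: two top cells through a common vertex u
-- of lk(a) are joined in lk(u) by the induction hypothesis, hence in lk(a); following an edge path
-- of lk(a) and choosing, by purity, a top cell over each edge connects any two top cells of lk(a)
-- (1 ⇒ 2).
module Submission where

open import Defs
open import Data.Nat using (ℕ; zero; suc; _+_; _∸_; _≤_; _<_; _<?_; z≤n; s≤s)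
open import Data.Nat.Properties
  using (_≟_; <-trans; <-irrefl; ≤-reflexive; ≤-trans; <-≤-trans; <⇒≤; >⇒≢; suc-injective; +-suc; +-comm;
         m≤n+m; m<m+n; 1+n≢n; n<1+n; m≤n⇒m≤1+n; m+n∸n≡m; m∸n+n≡m; ∸-cancelʳ-≡; +-∸-assoc; m≤n⇒∃[o]m+o≡n)
open import Data.List using ([]; _∷_; length; filter)
open import Data.List.Properties using (filter-accept; filter-reject; filter-all; ≡-dec)
open import Data.List.Membership.Propositional using (_∈_; _∉_)
open import Data.List.Membership.Propositional.Properties using (∈-filter⁺; ∈-filter⁻)
open import Data.List.Membership.DecPropositional _≟_ using (_∈?_)
open import Data.List.Relation.Binary.Subset.Propositional using (_⊆_)
open import Data.List.Relation.Binary.Subset.Propositional.Properties using (filter-⊆)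
open import Data.List.Relation.Unary.Any using (here; there; tail)
import Data.List.Relation.Unary.All as All
open import Data.List.Relation.Unary.AllPairs using (_∷_)
open import Data.List.Relation.Unary.Linked using (linked?)
import Data.List.Relation.Unary.Linked as Linked
open import Data.List.Relation.Unary.Linked.Properties using (Linked⇒AllPairs; filter⁺)
open import Data.Product using (∃-syntax; _×_; _,_; proj₁; proj₂)
open import Data.Empty using (⊥-elim)
open import Function.Base using (_∘_; _on_; flip)
open import Function.Bundles using (_⇔_; mk⇔; Equivalence)
open import Relation.Nullary using (¬_; ¬?; yes; no)
open import Relation.Nullary.Decidable using (recompute)
open import Relation.Unary using (Decidable)
open import Relation.Binary.PropositionalEquality using (_≡_; _≢_; refl; sym; trans; cong; subst; subst₂)
open import Relation.Binary.Construct.Closure.ReflexiveTransitive using (Star; ε; _◅_; _◅◅_; gmap; map; return; reverse)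

open Equivalence using (to; from)

+1≤⇒< : ∀ {m n} → m + 1 ≤ n → m < n
+1≤⇒< {m} {n} = subst (_≤ n) (+-comm m 1)

<⇒+1≤ : ∀ {m n} → m < n → m + 1 ≤ n
<⇒+1≤ {m} {n} = subst (_≤ n) (+-comm 1 m)

+suc≡⇒< : ∀ {m k n} → m + suc k ≡ n → m < n
+suc≡⇒< {m} eq = <-≤-trans (m<m+n m (s≤s z≤n)) (≤-reflexive eq)

filter-FinSet : ∀ {P : ℕ → Set} (P? : Decidable P) {xs} → FinSet xs → FinSet (filter P? xs)
filter-FinSet P? = filter⁺ P? <-trans

≢? : ∀ v → Decidable (_≢ v)
≢? v x = ¬? (x ≟ v)

∉-del : ∀ v τ → v ∉ del v τ
∉-del v τ v∈ = proj₂ (∈-filter⁻ (≢? v) {xs = τ} v∈) refl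

≡del⇒∉ : ∀ {σ τ v} → σ ≡ del v τ → v ∉ σ
≡del⇒∉ {τ = τ} {v} refl = ∉-del v τ

del-⊆ : ∀ v τ → del v τ ⊆ τ
del-⊆ v = filter-⊆ (≢? v)

∈-del⁺ : ∀ {x v τ} → x ∈ τ → x ≢ v → x ∈ del v τ
∈-del⁺ {v = v} = ∈-filter⁺ (≢? v)

⊆-del : ∀ {σ τ v} → σ ⊆ τ → v ∉ σ → σ ⊆ del v τ
⊆-del σ⊆τ v∉σ x∈σ = ∈-del⁺ (σ⊆τ x∈σ) (λ { refl → v∉σ x∈σ })

length-del : ∀ v τ → FinSet τ → v ∈ τ → suc (length (del v τ)) ≡ length τ
length-del v (x ∷ xs) fs v∈ with x ≟ v | Linked⇒AllPairs <-trans fs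
... | yes refl | x<xs ∷ _ =
  cong (suc ∘ length) (trans (filter-reject (≢? v) {xs = xs} (λ v≢v → v≢v refl))
                             (filter-all (≢? v) (All.map >⇒≢ x<xs)))
... | no x≢v | _ =
  trans (cong (suc ∘ length) (filter-accept (≢? v) {xs = xs} x≢v))
        (cong suc (length-del v xs (Linked.tail fs) (tail (x≢v ∘ sym) v∈)))

filter-cong-∈ : ∀ {P Q : ℕ → Set} (P? : Decidable P) (Q? : Decidable Q) xs →
                (∀ {x} → x ∈ xs → P x ⇔ Q x) → filter P? xs ≡ filter Q? xs
filter-cong-∈ P? Q? [] P⇔Q = refl
filter-cong-∈ P? Q? (x ∷ xs) P⇔Q with P? x | Q? x
... | yes _  | yes _  = cong (x ∷_) (filter-cong-∈ P? Q? xs (P⇔Q ∘ there))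
... | no _   | no _   = filter-cong-∈ P? Q? xs (P⇔Q ∘ there)
... | yes px | no ¬qx = ⊥-elim (¬qx (to (P⇔Q (here refl)) px))
... | no ¬px | yes qx = ⊥-elim (¬px (from (P⇔Q (here refl)) qx))

filter-comm : ∀ {P Q : ℕ → Set} (P? : Decidable P) (Q? : Decidable Q) xs →
              filter P? (filter Q? xs) ≡ filter Q? (filter P? xs)
filter-comm P? Q? [] = refl
filter-comm P? Q? (x ∷ xs) with P? x | Q? x
... | yes px | yes qx
  rewrite filter-accept P? {xs = filter Q? xs} px | filter-accept Q? {xs = filter P? xs} qx
  = cong (x ∷_) (filter-comm P? Q? xs)
... | yes px | no ¬qx rewrite filter-reject Q? {xs = filter P? xs} ¬qx = filter-comm P? Q? xs
... | no ¬px | yes qx rewrite filter-reject P? {xs = filter Q? xs} ¬px = filter-comm P? Q? xs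
... | no _   | no _   = filter-comm P? Q? xs

del-∩-del : ∀ v w τ → del v τ ∩ del w τ ≡ del w (del v τ)
del-∩-del v w τ = filter-cong-∈ (_∈? del w τ) (≢? w) (del v τ) λ x∈ →
  mk⇔ (λ x∈del → proj₂ (∈-filter⁻ (≢? w) {xs = τ} x∈del))
      (∈-del⁺ (del-⊆ v τ x∈))

del-comm : ∀ v w τ → del w (del v τ) ≡ del v (del w τ)
del-comm v w = filter-comm (≢? w) (≢? v)

-- ε forces both endpoints to agree, proof components included; closing with a step (R y y in
-- lift-path) is what allows arbitrary endpoint proofs p and q.
module _ {A : Set} {P : A → Set} {R : A → A → Set} (transport : ∀ {x y} → P x → R x y → P y) where

  lift-path⁺ : ∀ {x y z} → R x y → Star R y z → (p : P x) (q : P z) → Star (R on proj₁) (x , p) (z , q)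
  lift-path⁺ r ε         p q = r ◅ ε
  lift-path⁺ r (r′ ◅ rs) p q = r ◅ lift-path⁺ r′ rs (transport p r) q

  lift-path : ∀ {x y} → R y y → Star R x y → (p : P x) (q : P y) → Star (R on proj₁) (x , p) (y , q)
  lift-path r ε        = lift-path⁺ r ε
  lift-path _ (r ◅ rs) = lift-path⁺ r rs

module Multicomplex {d : ℕ} {D : MultiData} (M : IsMulticomplex d D) where
  open MultiNotions D
  open IsMulticomplex M

  size : MC → ℕ
  size x = length (cell x)

  cell-FinSet : (x : MC) → FinSet (cell x)
  cell-FinSet (mc σ σ∈X _) = recompute (linked? _<?_ σ) (X-finset σ σ∈X)

  facet : MC → ℕ → MC
  facet t@(mc τ τ∈X _) v = mc (del v τ) (X-closed _ τ τ∈X (filter-FinSet _ (cell-FinSet t)) (del-⊆ v τ)) (g t (del v τ))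

  facet-∂ : ∀ {t v} → v ∈ cell t → bdry (facet t v) t
  facet-∂ v∈t = (_ , v∈t , refl) , refl

  ∂-⊆ : ∀ {x y} → bdry x y → cell x ⊆ cell y
  ∂-⊆ {y = y} ((v , _ , eq) , _) = del-⊆ v (cell y) ∘ subst (_ ∈_) eq

  ∂-⊉ : ∀ {x y} → bdry x y → ¬ (cell y ⊆ cell x)
  ∂-⊉ {y = y} ((v , v∈y , eq) , _) y⊆x = ≡del⇒∉ {τ = cell y} eq (y⊆x v∈y)

  ∂-size : ∀ {x y} → bdry x y → suc (size x) ≡ size y
  ∂-size {y = y} ((v , v∈y , eq) , _) = trans (cong (suc ∘ length) eq) (length-del v (cell y) (cell-FinSet y) v∈y)

  ≼-⊆ : ∀ {x y} → x ≼ y → cell x ⊆ cell y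
  ≼-⊆ ε           = λ z∈x → z∈x
  ≼-⊆ {x} (_◅_ {j = z} x∂z z≼y) = λ w∈x → ≼-⊆ z≼y (∂-⊆ {x} {z} x∂z w∈x)

  ∂-< : ∀ {x y} → bdry x y → size x < size y
  ∂-< {x} {y} x∂y = ≤-reflexive (∂-size {x} {y} x∂y)

  ≼-size : ∀ {x y} → x ≼ y → size x ≤ size y
  ≼-size ε           = ≤-reflexive refl
  ≼-size {x} (_◅_ {j = z} x∂z z≼y) = ≤-trans (<⇒≤ (∂-< {x} {z} x∂z)) (≼-size z≼y)

  ◅-< : ∀ {x z y} → bdry x z → z ≼ y → size x < size y
  ◅-< {x} {z} x∂z z≼y = <-≤-trans (∂-< {x} {z} x∂z) (≼-size z≼y)

  ≼-uncons : ∀ {x y} → x ≼ y → size x < size y → ∃[ z ] (bdry x z × z ≼ y)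
  ≼-uncons ε           x<x = ⊥-elim (<-irrefl refl x<x)
  ≼-uncons (x∂z ◅ z≼y) _   = _ , x∂z , z≼y

  ≼-unsnoc : ∀ {x y} → x ≼ y → size x < size y → ∃[ z ] (x ≼ z × bdry z y)
  ≼-unsnoc ε                   x<x = ⊥-elim (<-irrefl refl x<x)
  ≼-unsnoc {x} (x∂y ◅ ε)       _   = x , ε , x∂y
  ≼-unsnoc (_◅_ {j = z} x∂z (z∂w ◅ w≼y)) _ with ≼-unsnoc {z} (z∂w ◅ w≼y) (◅-< {z} z∂w w≼y)
  ... | u , z≼u , u∂y = u , x∂z ◅ z≼u , u∂y

  ≼-∂ : ∀ {x y} → x ≼ y → size y ≡ suc (size x) → bdry x y
  ≼-∂ ε                     eq = ⊥-elim (1+n≢n (sym eq))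
  ≼-∂ (x∂y ◅ ε)             _  = x∂y
  ≼-∂ {x} (_◅_ {j = z} x∂z (z∂w ◅ w≼y)) eq =
    ⊥-elim (<-irrefl (sym (trans eq (∂-size {x} {z} x∂z))) (◅-< {z} z∂w w≼y))

  facet-unique : ∀ {c c' t} → bdry c t → bdry c' t → cell c ≡ cell c' → c ≡ c'
  facet-unique {mc σ p _} {mc .σ _ _} (_ , i≡) (_ , i'≡) refl = cong (mc σ p) (trans i≡ (sym i'≡))

  -- Consistency makes the copies of c ∩ c' under c and under c' one multicell.
  facets-meet : ∀ {c c' t} → bdry c t → bdry c' t → cell c ≢ cell c' →
                ∃[ r ] (bdry r c × bdry r c' × cell r ≡ cell c ∩ cell c')
  facets-meet {c@(mc _ _ _)} {c'@(mc _ _ _)} {t@(mc τ τ∈X _)}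
              c∂t@((v , v∈t , refl) , _) c'∂t@((w , w∈t , refl) , _) c≢c' =
    r , ((w , ∈-del⁺ w∈t w≢v , del-∩-del v w τ) , sym glued) ,
        ((v , ∈-del⁺ v∈t v≢w , trans (del-∩-del v w τ) (del-comm v w τ)) , refl) , refl
    where
    ρ = del v τ ∩ del w τ
    v≢w : v ≢ w
    v≢w refl = c≢c' refl
    w≢v : w ≢ v
    w≢v = v≢w ∘ sym
    r : MC
    r = mc ρ (X-closed ρ τ τ∈X (filter-FinSet _ (filter-FinSet _ (cell-FinSet t)))
                              (λ x∈ρ → del-⊆ v τ (filter-⊆ _ (del v τ) x∈ρ)))
             (g c' ρ)
    glued : g c ρ ≡ g c' ρ
    glued = consistent c c' t (c∂t ◅ ε) (c'∂t ◅ ε)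
      (suc-injective (trans (∂-size {c} {t} c∂t) (sym (∂-size {c'} {t} c'∂t))))
      (trans (cong (suc ∘ length) (del-∩-del v w τ))
             (length-del w (del v τ) (filter-FinSet _ (cell-FinSet t)) (∈-del⁺ w∈t w≢v)))

  -- Descend from t along a ≼ t: its first facet c' is either c or meets c in a facet of c.
  ≼-facet : ∀ {a c t} → a ≼ t → bdry c t → cell a ⊆ cell c → a ≼ c
  ≼-facet a≼t = descend (reverse (λ t∂u → t∂u) a≼t)
    where
    descend : ∀ {a c t} → Star (flip bdry) t a → bdry c t → cell a ⊆ cell c → a ≼ c
    descend {c = c} {t} ε c∂t t⊆c = ⊥-elim (∂-⊉ {c} {t} c∂t t⊆c)
    descend {a} {c} {t} (_◅_ {j = c'} c'∂t c'↓a) c∂t a⊆c with ≡-dec _≟_ (cell c) (cell c')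
    ... | yes c≡c' = subst (a ≼_) (sym (facet-unique {c} {c'} {t} c∂t c'∂t c≡c')) (reverse (λ u∂v → u∂v) c'↓a)
    ... | no c≢c' with facets-meet {c} {c'} {t} c∂t c'∂t c≢c'
    ...   | r , r∂c , r∂c' , r≡c∩c' = descend {c = r} c'↓a r∂c' a⊆r ◅◅ return r∂c
      where
      a⊆r : cell a ⊆ cell r
      a⊆r x∈a = subst (_ ∈_) (sym r≡c∩c')
                  (∈-filter⁺ (_∈? cell c') (a⊆c x∈a) (≼-⊆ (reverse (λ u∂v → u∂v) c'↓a) x∈a))

  ≼-facet-without : ∀ {a t v} → a ≼ t → v ∈ cell t → v ∉ cell a → a ≼ facet t v
  ≼-facet-without {t = t} a≼t v∈t v∉a = ≼-facet a≼t (facet-∂ {t} v∈t) (⊆-del (≼-⊆ a≼t) v∉a)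

  ∂-new-unique : ∀ {a u x y} → bdry a u → x ∈ cell u → y ∈ cell u → x ∉ cell a → y ∉ cell a → x ≡ y
  ∂-new-unique {a} {u} ((w , _ , a≡) , _) x∈u y∈u x∉a y∉a = trans (≡w x∈u x∉a) (sym (≡w y∈u y∉a))
    where
    ≡w : ∀ {x} → x ∈ cell u → x ∉ cell a → x ≡ w
    ≡w {x} x∈u x∉a with x ≟ w
    ... | yes x≡w = x≡w
    ... | no x≢w  = ⊥-elim (x∉a (subst (_ ∈_) (sym a≡) (∈-del⁺ x∈u x≢w)))

  -- u misses two vertices of T, while u' has only one vertex outside a.
  vertex-outside : ∀ {a u u' T} → bdry a u → bdry a u' → u ≼ T → suc (size u) < size T →
                   ∃[ z ] (z ∈ cell T × z ∉ cell u × z ∉ cell u')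
  vertex-outside {a} {u} {u'} {T} a∂u a∂u' u≼T u+1<T with ≼-uncons u≼T (<-trans (n<1+n _) u+1<T)
  ... | f , u∂f@((v , v∈f , u≡) , _) , f≼T with ≼-uncons f≼T (subst (_< size T) (∂-size {u} {f} u∂f) u+1<T)
  ...   | f' , ((z , z∈f' , f≡) , _) , f'≼T with v ∈? cell u'
  ...     | no v∉u' = v , ≼-⊆ f≼T v∈f , ≡del⇒∉ {τ = cell f} u≡ , v∉u'
  ...     | yes v∈u' = z , ≼-⊆ f'≼T z∈f' , z∉f ∘ ∂-⊆ {u} {f} u∂f , z∉u'
    where
    z∉f : z ∉ cell f
    z∉f = ≡del⇒∉ {τ = cell f'} f≡
    ∉a : ∀ {x} → x ∉ cell u → x ∉ cell a
    ∉a x∉u = x∉u ∘ ∂-⊆ {a} {u} a∂u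
    z∉u' : z ∉ cell u'
    z∉u' z∈u' = z∉f (subst (_∈ cell f) (∂-new-unique {a} {u'} a∂u' v∈u' z∈u' (∉a (≡del⇒∉ {τ = cell f} u≡))
                                                      (∉a (z∉f ∘ ∂-⊆ {u} {f} u∂f))) v∈f)

  common-edge : ∀ {a u u' T} → bdry a u → bdry a u' → u ≼ T → u' ≼ T → size u < size T →
                ∃[ e ] (bdry u e × bdry u' e)
  common-edge {a} {u} {u'} {T} a∂u a∂u' u≼T u'≼T u<T = go _ (sym (m∸n+n≡m u<T)) u≼T u'≼T
    where
    go : ∀ k {T} → size T ≡ k + suc (size u) → u ≼ T → u' ≼ T → ∃[ e ] (bdry u e × bdry u' e)
    go zero    {T} T≡ u≼T u'≼T =
      T , ≼-∂ u≼T T≡ , ≼-∂ u'≼T (trans T≡ (cong suc (trans (sym (∂-size {a} {u} a∂u)) (∂-size {a} {u'} a∂u'))))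
    go (suc k) {T} T≡ u≼T u'≼T
      with vertex-outside {a} {u} {u'} a∂u a∂u' u≼T (subst (suc (size u) <_) (sym T≡) (s≤s (m≤n+m _ k)))
    ... | z , z∈T , z∉u , z∉u' =
      go k (suc-injective (trans (∂-size {facet T z} {T} (facet-∂ {T} z∈T)) T≡))
           (≼-facet-without u≼T z∈T z∉u) (≼-facet-without u'≼T z∈T z∉u')

  -- A cell of lk(a) is a pair (b , a ≼ b), and the relations of lk(a) ignore the second component.
  ∂⇒link-∂ : ∀ {a} {X Y : Cplx.Cell (Link a)} → bdry (proj₁ X) (proj₁ Y) → Cplx.bd (Link a) X Y
  ∂⇒link-∂ {X = x , a≼x} {y , _} ((v , v∈y , x≡) , i≡) = v , v∈y , ≡del⇒∉ {τ = cell y} x≡ ∘ ≼-⊆ a≼x , x≡ , i≡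

  link-∂⇒∂ : ∀ {a} {X Y : Cplx.Cell (Link a)} → Cplx.bd (Link a) X Y → bdry (proj₁ X) (proj₁ Y)
  link-∂⇒∂ (v , v∈y , _ , x≡ , i≡) = (v , v∈y , x≡) , i≡

  ≼⇒link-≼ : ∀ {a} {X Y : Cplx.Cell (Link a)} → proj₁ X ≼ proj₁ Y → size (proj₁ X) < size (proj₁ Y) →
             Star (Cplx.bd (Link a)) X Y
  ≼⇒link-≼ ε x<x = ⊥-elim (<-irrefl refl x<x)
  ≼⇒link-≼ {X = _ , a≼x} {_ , a≼y} (x∂z ◅ z≼y) _ =
    map (λ {X} {Y} → ∂⇒link-∂ {X = X} {Y}) (lift-path⁺ (λ a≼u u∂v → a≼u ◅◅ return u∂v) x∂z z≼y a≼x a≼y)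

  link-≼⇒≼ : ∀ {a} {X Y : Cplx.Cell (Link a)} → Star (Cplx.bd (Link a)) X Y → proj₁ X ≼ proj₁ Y
  link-≼⇒≼ = gmap proj₁ (λ {X} {Y} → link-∂⇒∂ {X = X} {Y})

  Top : MC → Set
  Top T = size T ≡ suc d

  <-top : ∀ {x T} → size x ≤ d → Top T → size x < size T
  <-top {x} x≤d T-top = subst (size x <_) (sym T-top) (s≤s x≤d)

  LinkEdge : MC → MC → MC → Set
  LinkEdge a u w = bdry a u × bdry a w × ∃[ e ] (bdry u e × bdry w e)

  SharedFacet : MC → MC → MC → Set
  SharedFacet a T T' = Top T × Top T' × ∃[ c ] (size c ≡ d × a ≼ c × c ≼ T × c ≼ T')

  VerticesConnected : MC → Set
  VerticesConnected a = ∀ {u w} → bdry a u → bdry a w → Star (LinkEdge a) u w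

  TopsConnected : MC → Set
  TopsConnected a = ∀ {T T'} → a ≼ T → a ≼ T' → Top T → Top T' → Star (SharedFacet a) T T'

  sharedFacet-weaken : ∀ {a u T T'} → a ≼ u → SharedFacet u T T' → SharedFacet a T T'
  sharedFacet-weaken a≼u (T-top , T'-top , c , c-size , u≼c , c≼T) = T-top , T'-top , c , c-size , a≼u ◅◅ u≼c , c≼T

  sharedFacet-refl : ∀ {a T} → size a ≤ d → a ≼ T → Top T → SharedFacet a T T
  sharedFacet-refl {a} {T} a≤d a≼T T-top with ≼-unsnoc a≼T (<-top {a} {T} a≤d T-top)
  ... | c , a≼c , c∂T =
    T-top , T-top , c , suc-injective (trans (∂-size {c} {T} c∂T) T-top) , a≼c , return c∂T , return c∂T

  link-vertex : ∀ {a u} → a ≼ u → size u ∸ size a ≡ 1 → bdry a u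
  link-vertex {a} a≼u u-size = ≼-∂ a≼u (trans (sym (m∸n+n≡m (≼-size a≼u))) (cong (_+ size a) u-size))

  vertex-link-size : ∀ {a u} → bdry a u → size u ∸ size a ≡ 1
  vertex-link-size {a} {u} a∂u = trans (cong (_∸ size a) (sym (∂-size {a} {u} a∂u))) (m+n∸n≡m 1 (size a))

  module _ {a : MC} where
    open CplxNotions (Link a) using (Adjacent; Neighbours)

    adjacent⇒linkEdge : ∀ {X Y} → Adjacent X Y → (LinkEdge a on proj₁) X Y
    adjacent⇒linkEdge {u , a≼u} {w , a≼w} (u-size , w-size , E , _ , u∂E , w∂E) =
      link-vertex a≼u u-size , link-vertex a≼w w-size , proj₁ E ,
      link-∂⇒∂ {X = u , a≼u} {E} u∂E , link-∂⇒∂ {X = w , a≼w} {E} w∂E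

    linkEdge⇒adjacent : ∀ {X Y} → (LinkEdge a on proj₁) X Y → Adjacent X Y
    linkEdge⇒adjacent {u , a≼u} {w , a≼w} (a∂u , a∂w , e , u∂e , w∂e) =
      vertex-link-size {a} {u} a∂u , vertex-link-size {a} {w} a∂w , E , e-size ,
      ∂⇒link-∂ {X = u , a≼u} {E} u∂e , ∂⇒link-∂ {X = w , a≼w} {E} w∂e
      where
      E = e , a≼u ◅◅ return u∂e
      e-size : size e ∸ size a ≡ 2
      e-size = trans (cong (_∸ size a) (sym (trans (cong suc (∂-size {a} {u} a∂u)) (∂-size {u} {e} u∂e))))
                     (m+n∸n≡m 2 (size a))

    neighbours⇒sharedFacet : size a ≤ d → ∀ {X Y} → Neighbours (suc d ∸ size a) X Y → (SharedFacet a on proj₁) X Y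
    neighbours⇒sharedFacet a≤d {T , a≼T} {T' , a≼T'} (T-size , T'-size , (c , a≼c) , c-size , c≼T , c≼T') =
      top a≼T T-size , top a≼T' T'-size , c ,
      ∸-cancelʳ-≡ (≼-size a≼c) a≤d (suc-injective (trans c-size (+-∸-assoc 1 a≤d))) ,
      a≼c , link-≼⇒≼ c≼T , link-≼⇒≼ c≼T'
      where
      top : ∀ {T} → a ≼ T → size T ∸ size a ≡ suc d ∸ size a → Top T
      top a≼T = ∸-cancelʳ-≡ (≼-size a≼T) (m≤n⇒m≤1+n a≤d)

    sharedFacet⇒neighbours : size a ≤ d → ∀ {X Y} → (SharedFacet a on proj₁) X Y → Neighbours (suc d ∸ size a) X Y
    sharedFacet⇒neighbours a≤d {T , a≼T} {T' , a≼T'} (T-top , T'-top , c , c-size , a≼c , c≼T , c≼T') =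
      cong (_∸ size a) T-top , cong (_∸ size a) T'-top , (c , a≼c) ,
      trans (cong (λ n → suc (n ∸ size a)) c-size) (sym (+-∸-assoc 1 a≤d)) ,
      ≼⇒link-≼ {X = c , a≼c} {T , a≼T} c≼T (below {T} T-top) ,
      ≼⇒link-≼ {X = c , a≼c} {T' , a≼T'} c≼T' (below {T'} T'-top)
      where
      below : ∀ {T} → Top T → size c < size T
      below T-top = subst₂ _<_ (sym c-size) (sym T-top) (n<1+n d)

  lowerPathConnected⇔ : ∀ {a} → size a ≤ d →
                         CplxNotions.LowerPathConnected (Link a) (suc d ∸ size a) ⇔ TopsConnected a
  lowerPathConnected⇔ {a} a≤d = mk⇔
    (λ connected {T} {T'} a≼T a≼T' T-top T'-top →
       gmap proj₁ (neighbours⇒sharedFacet a≤d)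
         (connected (T , a≼T) (T' , a≼T') (cong (_∸ size a) T-top) (cong (_∸ size a) T'-top)))
    (λ connected (T , a≼T) (T' , a≼T') T-size T'-size →
       let T-top  = ∸-cancelʳ-≡ (≼-size a≼T) (m≤n⇒m≤1+n a≤d) T-size
           T'-top = ∸-cancelʳ-≡ (≼-size a≼T') (m≤n⇒m≤1+n a≤d) T'-size
       in map (sharedFacet⇒neighbours a≤d)
            (lift-path (λ _ (_ , _ , _ , _ , a≼c , _ , c≼T') → a≼c ◅◅ c≼T')
                       (sharedFacet-refl a≤d a≼T' T'-top) (connected a≼T a≼T' T-top T'-top) a≼T a≼T'))

  module _ (pure : Pure d D) where

    linkEdge-refl : ∀ {a w} → size a < d → bdry a w → LinkEdge a w w
    linkEdge-refl {a} {w} a<d a∂w with pure w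
    ... | T , T-top , w≼T with ≼-uncons w≼T (<-top {w} {T} (subst (_≤ d) (∂-size {a} {w} a∂w) a<d) T-top)
    ...   | e , w∂e , _ = a∂w , a∂w , e , w∂e , w∂e

    oneSkeletonConnected⇔ : ∀ {a} → size a < d →
                             CplxNotions.OneSkeletonConnected (Link a) ⇔ VerticesConnected a
    oneSkeletonConnected⇔ {a} a<d = mk⇔
      (λ connected {u} {w} a∂u a∂w →
         gmap proj₁ (λ {X} {Y} → adjacent⇒linkEdge {a} {X} {Y})
           (connected (u , return a∂u) (w , return a∂w) (vertex-link-size {a} {u} a∂u) (vertex-link-size {a} {w} a∂w)))
      (λ connected (u , a≼u) (w , a≼w) u-size w-size →
         let a∂w = link-vertex a≼w w-size
         in map (λ {X} {Y} → linkEdge⇒adjacent {a} {X} {Y})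
              (lift-path (λ _ (_ , a∂v , _) → return a∂v) (linkEdge-refl {a} {w} a<d a∂w)
                         (connected (link-vertex a≼u u-size) a∂w) a≼u a≼w))

    module _ (vertices-connected : ∀ {a} → size a < d → VerticesConnected a) where
      mutual
        tops-connected : ∀ k {a} → size a + suc k ≡ d → TopsConnected a
        tops-connected k {a} a+k≡d {T} {T'} a≼T a≼T' T-top T'-top
          with ≼-uncons a≼T (<-top {a} {T} a≤d T-top) | ≼-uncons a≼T' (<-top {a} {T'} a≤d T'-top)
          where a≤d = <⇒≤ (+suc≡⇒< a+k≡d)
        ... | u , a∂u , u≼T | w , a∂w , w≼T' =
          along-edges k a+k≡d (vertices-connected {a} (+suc≡⇒< a+k≡d) {u} {w} a∂u a∂w) a∂u u≼T w≼T' T-top T'-top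

        along-edges : ∀ k {a u w T T'} → size a + suc k ≡ d → Star (LinkEdge a) u w → bdry a u →
                      u ≼ T → w ≼ T' → Top T → Top T' → Star (SharedFacet a) T T'
        along-edges k a+k≡d ε a∂u u≼T u≼T' = through-vertex k a+k≡d a∂u u≼T u≼T'
        along-edges k a+k≡d ((a∂u , a∂v , e , u∂e , v∂e) ◅ edges) _ u≼T w≼T' T-top T'-top with pure e
        ... | T'' , T''-top , e≼T'' =
          through-vertex k a+k≡d a∂u u≼T (u∂e ◅ e≼T'') T-top T''-top
          ◅◅ along-edges k a+k≡d edges a∂v (v∂e ◅ e≼T'') w≼T' T''-top T'-top

        through-vertex : ∀ k {a u T T'} → size a + suc k ≡ d → bdry a u →
                         u ≼ T → u ≼ T' → Top T → Top T' → Star (SharedFacet a) T T'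
        through-vertex zero {a} {u} a+1≡d a∂u u≼T u≼T' T-top T'-top =
          return (T-top , T'-top , u , trans (sym (∂-size {a} {u} a∂u)) (trans (+-comm 1 (size a)) a+1≡d) ,
                  return a∂u , u≼T , u≼T')
        through-vertex (suc k) {a} {u} a+k≡d a∂u u≼T u≼T' T-top T'-top =
          map (sharedFacet-weaken (return a∂u)) (tops-connected k u+k≡d u≼T u≼T' T-top T'-top)
          where
          u+k≡d : size u + suc k ≡ d
          u+k≡d = trans (cong (_+ suc k) (sym (∂-size {a} {u} a∂u))) (trans (sym (+-suc (size a) (suc k))) a+k≡d)

      verticesConnected⇒topsConnected : ∀ {a} → size a < d → TopsConnected a
      verticesConnected⇒topsConnected {a} a<d with m≤n⇒∃[o]m+o≡n a<d
      ... | k , a+k≡d = tops-connected k (trans (+-suc (size a) k) a+k≡d)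

    topsConnected⇒verticesConnected : ∀ {a} → size a < d → TopsConnected a → VerticesConnected a
    topsConnected⇒verticesConnected {a} a<d connected {u} {w} a∂u a∂w with pure u | pure w
    ... | T , T-top , u≼T | T' , T'-top , w≼T' =
      along-facets (connected (a∂u ◅ u≼T) (a∂w ◅ w≼T') T-top T'-top) T-top a∂u a∂w u≼T w≼T'
      where
      edge-in : ∀ {T u w} → Top T → bdry a u → bdry a w → u ≼ T → w ≼ T → LinkEdge a u w
      edge-in {T} {u} T-top a∂u a∂w u≼T w≼T =
        a∂u , a∂w , common-edge {a} a∂u a∂w u≼T w≼T (<-top {u} {T} (subst (_≤ d) (∂-size {a} {u} a∂u) a<d) T-top)

      along-facets : ∀ {T T' u w} → Star (SharedFacet a) T T' → Top T → bdry a u → bdry a w →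
                     u ≼ T → w ≼ T' → Star (LinkEdge a) u w
      along-facets ε T-top a∂u a∂w u≼T w≼T = return (edge-in T-top a∂u a∂w u≼T w≼T)
      along-facets ((_ , T''-top , c , c-size , a≼c , c≼T , c≼T'') ◅ facets) T-top a∂u a∂w u≼T w≼T'
        with ≼-uncons a≼c (subst (size a <_) (sym c-size) a<d)
      ... | v , a∂v , v≼c =
        edge-in T-top a∂u a∂v u≼T (v≼c ◅◅ c≼T)
        ◅ along-facets facets T''-top a∂v a∂w (v≼c ◅◅ c≼T'') w≼T'

proposition3p5 : (d : ℕ) (D : MultiData) → IsMulticomplex d D → Pure d D →
    LinkConnected d D ⇔ LinksLowerPathConnected d D
proposition3p5 d D M pure = mk⇔
  (λ link-connected a a+1≤d →
     let a<d = +1≤⇒< a+1≤d in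
     from (lowerPathConnected⇔ {a} (<⇒≤ a<d))
          (verticesConnected⇒topsConnected pure
             (λ {b} b<d → to (oneSkeletonConnected⇔ pure b<d) (link-connected b (<⇒+1≤ b<d))) a<d))
  (λ links-lower-path-connected a a+1≤d →
     let a<d = +1≤⇒< a+1≤d in
     from (oneSkeletonConnected⇔ pure {a} a<d)
          (topsConnected⇒verticesConnected pure a<d
             (to (lowerPathConnected⇔ {a} (<⇒≤ a<d)) (links-lower-path-connected a a+1≤d))))
  where open Multicomplex M
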